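{- Let $t\ge 5$ be an odd integer and let $d$ be an integer with $d\ge t-3$. Then $$\chi_d(G_t)=1+t\left(d-\frac{t-3}{2}\right).$$
   Context: For an odd integer $t\ge 3$, $G_t$ denotes the integer distance graph $G(\mathbb{Z},\{2,t\})$: its vertex set is $\mathbb{Z}$, and distinct $i,j\in\mathbb{Z}$ are adjacent if and only if $|i-j|\in\{2,t\}$. For a graph $G$ and a positive integer $d$, a $d$-distance $k$-coloring is a map $f:V(G)\to\{1,\ldots,k\}$ such that any two distinct vertices $u,v$ with $f(u)=f(v)$ satisfy $d_G(u,v)>d$ ($d_G$ the shortest-path distance); $\chi_d(G)$ is the smallest such $k$. -}

module Defs where

open import Data.Nat using (ℕ; zero; suc; _+_; _*_; _∸_; _≤_)
open import Data.Integer using (ℤ; +_; ∣_∣; _-_)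
open import Data.Fin using (Fin)
open import Data.Sum using (_⊎_)
open import Data.Product using (Σ; _×_)
open import Relation.Binary.PropositionalEquality using (_≡_; _≢_)
open import Relation.Nullary using (¬_)

-- adjacency in the distance graph G(ℤ,{2,t}): |i - j| ∈ {2, t}
Adj : ℕ → ℤ → ℤ → Set
Adj t i j = (∣ i - j ∣ ≡ 2) ⊎ (∣ i - j ∣ ≡ t)

data Within (t : ℕ) : ℕ → ℤ → ℤ → Set where
  here : ∀ {n u} → Within t n u u
  step : ∀ {n u w v} → Adj t u w → Within t n w v → Within t (suc n) u v

IsDistColoring : ℕ → ℕ → (k : ℕ) → (ℤ → Fin k) → Set
IsDistColoring t d k f =
  ∀ u v → u ≢ v → f u ≡ f v → ¬ Within t d u v

DistColorable : ℕ → ℕ → ℕ → Set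
DistColorable t d k = Σ (ℤ → Fin k) (IsDistColoring t d k)

ChiDistEq : ℕ → ℕ → ℕ → Set
ChiDistEq t d k = DistColorable t d k × (∀ j → suc j ≤ k → ¬ DistColorable t d j)

module Submission where

-- Write t = 2p + 3, d = p + e and k = 1 + t e.  A walk is determined up to order by
-- its numbers of moves by +2, +t, −2, −t, so d(u, u + δ) ≤ n says exactly that δ is
-- the balance of at most n such moves (Displacement).
-- Upper bound: colour u by u mod k.  Two vertices of equal colour differ by j k with
-- j ≥ 1, which is not a balance of p + e moves: for j ≥ 2 since t (p + e) < 2 k, and
-- for j = 1 compare the +t moves with e plus the −t moves.  If they overshoot, the
-- −2 moves must cancel at least t; otherwise parity makes them fall short by r t
-- with r ≥ 1, which the +2 moves must cover at a cost of at least p + 1 + r moves.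
-- Lower bound: every δ ∈ [1, t e] is the balance of at most p + e moves (t-moves and
-- a remainder in [2, t], which costs at most p + 1 moves, or t + 1 = 2 (p + 2)), so
-- the vertices 0, …, k − 1 are pairwise within distance d.  This needs e ≥ 2; the
-- remaining case t = 5, d = 2 is settled by an exhaustive search.

open import Defs
open import Data.Bool using (Bool; true; false; not; _∧_; T)
open import Data.Bool.ListAction using (all; any)
open import Data.Bool.Properties using (T-∧)
open import Data.Fin using (Fin; toℕ; fromℕ<; inject≤; _≟_)
open import Data.Fin.Properties using (toℕ-fromℕ<; toℕ<n; inject≤-injective; pigeonhole)
open import Data.Integer as ℤ using (ℤ; +_; +[1+_]; -[1+_]; ∣_∣; _%ℕ_; _/ℕ_)
import Data.Integer.DivMod as ℤ
import Data.Integer.Properties as ℤP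
open import Algebra.Properties.AbelianGroup (ℤP.+-0-abelianGroup) using (∙-cancelˡ)
import Data.Integer.Tactic.RingSolver as ℤ-Solver
open import Data.List using (List; []; _∷_; drop; allFin)
open import Data.List.Membership.Propositional using (_∈_; lose)
open import Data.List.Membership.Propositional.Properties using (∈-allFin)
import Data.List.Relation.Unary.All as All
open import Data.List.Relation.Unary.All.Properties using (all⁻)
open import Data.List.Relation.Unary.Any using (here; there)
open import Data.List.Relation.Unary.Any.Properties using (any⁺)
open import Data.Nat using (ℕ; zero; suc; _+_; _*_; _∸_; _≤_; _<_; z≤n; s≤s; s≤s⁻¹; z<s; _≤?_; NonZero)
open import Data.Nat.DivMod using (_%_; _/_; m≡m%n+[m/n]*n; m%n<n; [m+kn]%n≡m%n; m*n%n≡0)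
open import Data.Nat.Properties hiding (_≟_)
import Data.Nat.Tactic.RingSolver as ℕ-Solver
open import Data.Product using (Σ-syntax; ∃-syntax; _×_; _,_; proj₂)
open import Data.Sum using (_⊎_; inj₁; inj₂)
import Data.Sum as Sum
open import Function using (_$_)
open import Function.Bundles using (Equivalence)
open import Relation.Nullary using (¬_; does; yes; no; contradiction)
open import Relation.Binary.PropositionalEquality

stride : ℕ → ℕ → ℕ → ℕ
stride t a b = a * 2 + b * t

record Moves (t n : ℕ) : Set where
  constructor moves
  field
    up₂ upₜ down₂ downₜ : ℕ
    count≤ : up₂ + upₜ + (down₂ + downₜ) ≤ n

  rise : ℕ
  rise = stride t up₂ upₜ

  fall : ℕ
  fall = stride t down₂ downₜ

open Moves using (rise; fall)

stride-suc₂ : ∀ {t} a b → stride t (suc a) b ≡ 2 + stride t a b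
stride-suc₂ {t} a b = +-assoc 2 (a * 2) (b * t)

stride-sucₜ : ∀ {t} a b → stride t a (suc b) ≡ t + stride t a b
stride-sucₜ {t} a b = shuffle t a b
  where
  shuffle : ∀ t a b → a * 2 + (t + b * t) ≡ t + (a * 2 + b * t)
  shuffle = ℕ-Solver.solve-∀

record Displacement (t n δ : ℕ) : Set where
  constructor _,_
  field
    counts  : Moves t n
    balance : rise counts ≡ δ + fall counts

module _ {t : ℕ} where

  Adj-sym : ∀ u v → Adj t u v → Adj t v u
  Adj-sym u v = Sum.map (trans (ℤP.∣i-j∣≡∣j-i∣ v u)) (trans (ℤP.∣i-j∣≡∣j-i∣ v u))

  Adj-shift : ∀ w {s} → s ≡ 2 ⊎ s ≡ t → Adj t w (w ℤ.+ + s)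
  Adj-shift w {s} = Sum.map (trans ∣w-[w+s]∣≡s) (trans ∣w-[w+s]∣≡s)
    where
    w-[w+z]≡-z : ∀ w z → w ℤ.- (w ℤ.+ z) ≡ ℤ.- z
    w-[w+z]≡-z = ℤ-Solver.solve-∀
    ∣w-[w+s]∣≡s : ∣ w ℤ.- (w ℤ.+ + s) ∣ ≡ s
    ∣w-[w+s]∣≡s = trans (cong ∣_∣ (w-[w+z]≡-z w (+ s))) (ℤP.∣-i∣≡∣i∣ (+ s))

  Within-mono : ∀ {m n u v} → m ≤ n → Within t m u v → Within t n u v
  Within-mono _         here          = here
  Within-mono (s≤s m≤n) (step a walk) = step a (Within-mono m≤n walk)

  Within-trans : ∀ {m n u w v} → Within t m u w → Within t n w v → Within t (m + n) u v
  Within-trans here          walk′ = Within-mono (m≤n+m _ _) walk′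
  Within-trans (step a walk) walk′ = step a (Within-trans walk walk′)

  Within-snoc : ∀ {n u w v} → Within t n u w → Adj t w v → Within t (suc n) u v
  Within-snoc here          a′ = step a′ here
  Within-snoc (step a walk) a′ = step a (Within-snoc walk a′)

  Within-sym : ∀ {n u v} → Within t n u v → Within t n v u
  Within-sym here          = here
  Within-sym (step {u = u} {w} a walk) = Within-snoc (Within-sym walk) (Adj-sym u w a)

  climb : ∀ {s} → s ≡ 2 ⊎ s ≡ t → ∀ c w → Within t c w (w ℤ.+ + (c * s))
  climb _ zero w = subst (Within t 0 w) (sym (ℤP.+-identityʳ w)) here
  climb {s} s∈ (suc c) w = step (Adj-shift w s∈)
    (subst (Within t c _) (ℤP.+-assoc w (+ s) (+ (c * s))) (climb s∈ c (w ℤ.+ + s)))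

  ascend : ∀ a b u → Within t (a + b) u (u ℤ.+ + stride t a b)
  ascend a b u = subst (Within t (a + b) u) (ℤP.+-assoc u (+ (a * 2)) (+ (b * t)))
    (Within-trans (climb (inj₁ refl) a u) (climb (inj₂ refl) b (u ℤ.+ + (a * 2))))

  -- u and v both climb to the common point u + rise = v + fall.
  Moves⇒Within : ∀ {n u v} (m : Moves t n) → u ℤ.+ + rise m ≡ v ℤ.+ + fall m → Within t n u v
  Moves⇒Within {u = u} {v} (moves a b c f count≤) balance = Within-mono count≤ $
    Within-trans (ascend a b u) (subst (λ w → Within t (c + f) w v) (sym balance) (Within-sym (ascend c f v)))

  Within⇒Moves : ∀ {n u v} → Within t n u v → Σ[ m ∈ Moves t n ] u ℤ.+ + rise m ≡ v ℤ.+ + fall m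
  Within⇒Moves here = moves 0 0 0 0 z≤n , refl
  Within⇒Moves {suc n} {u} {v} (step {w = w} adj walk) = extend adj (Within⇒Moves walk)
    where
    down : ∀ {s R F} → + s ≡ u ℤ.- w → w ℤ.+ + R ≡ v ℤ.+ + F → u ℤ.+ + R ≡ v ℤ.+ + (s + F)
    down {s} {R} {F} s≡u-w balance = begin
      u ℤ.+ + R                    ≡⟨ regroup u w (+ R) ⟩
      (u ℤ.- w) ℤ.+ (w ℤ.+ + R)    ≡⟨ cong₂ ℤ._+_ (sym s≡u-w) balance ⟩
      + s ℤ.+ (v ℤ.+ + F)          ≡⟨ swap (+ s) v (+ F) ⟩
      v ℤ.+ (+ s ℤ.+ + F)          ∎
      where
      open ≡-Reasoning
      regroup : ∀ u w x → u ℤ.+ x ≡ (u ℤ.- w) ℤ.+ (w ℤ.+ x)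
      regroup = ℤ-Solver.solve-∀
      swap : ∀ x v y → x ℤ.+ (v ℤ.+ y) ≡ v ℤ.+ (x ℤ.+ y)
      swap = ℤ-Solver.solve-∀

    up : ∀ {s R F} → + s ≡ ℤ.- (u ℤ.- w) → w ℤ.+ + R ≡ v ℤ.+ + F → u ℤ.+ + (s + R) ≡ v ℤ.+ + F
    up {s} {R} {F} s≡w-u balance = begin
      u ℤ.+ (+ s ℤ.+ + R)              ≡⟨ cong (λ x → u ℤ.+ (x ℤ.+ + R)) s≡w-u ⟩
      u ℤ.+ (ℤ.- (u ℤ.- w) ℤ.+ + R)    ≡⟨ cancel u w (+ R) ⟩
      w ℤ.+ + R                        ≡⟨ balance ⟩
      v ℤ.+ + F                        ∎
      where
      open ≡-Reasoning
      cancel : ∀ u w x → u ℤ.+ (ℤ.- (u ℤ.- w) ℤ.+ x) ≡ w ℤ.+ x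
      cancel = ℤ-Solver.solve-∀

    sign : ∀ {s} → ∣ u ℤ.- w ∣ ≡ s → + s ≡ u ℤ.- w ⊎ + s ≡ ℤ.- (u ℤ.- w)
    sign refl = ℤP.+∣i∣≡i⊎+∣i∣≡-i (u ℤ.- w)

    extend : Adj t u w → Σ[ m ∈ Moves t n ] w ℤ.+ + rise m ≡ v ℤ.+ + fall m →
             Σ[ m ∈ Moves t (suc n) ] u ℤ.+ + rise m ≡ v ℤ.+ + fall m
    extend (inj₁ ∣u-w∣≡2) (moves a b c f count≤ , balance) with sign ∣u-w∣≡2
    ... | inj₁ s≡u-w = moves a b (suc c) f (≤-trans (≤-reflexive (+-suc (a + b) (c + f))) (s≤s count≤))
                     , trans (down s≡u-w balance) (cong (λ x → v ℤ.+ + x) (sym (stride-suc₂ c f)))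
    ... | inj₂ s≡w-u = moves (suc a) b c f (s≤s count≤)
                     , trans (cong (λ x → u ℤ.+ + x) (stride-suc₂ a b)) (up s≡w-u balance)
    extend (inj₂ ∣u-w∣≡t) (moves a b c f count≤ , balance) with sign ∣u-w∣≡t
    ... | inj₁ s≡u-w = moves a b c (suc f) (≤-trans (≤-reflexive (trans (cong (_+_ (a + b)) (+-suc c f)) (+-suc (a + b) (c + f)))) (s≤s count≤))
                     , trans (down s≡u-w balance) (cong (λ x → v ℤ.+ + x) (sym (stride-sucₜ c f)))
    ... | inj₂ s≡w-u = moves a (suc b) c f (≤-trans (≤-reflexive (cong (_+ (c + f)) (+-suc a b))) (s≤s count≤))
                     , trans (cong (λ x → u ℤ.+ + x) (stride-sucₜ a b)) (up s≡w-u balance)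

  Displacement⇒Within : ∀ {n δ u} → Displacement t n δ → Within t n u (u ℤ.+ + δ)
  Displacement⇒Within {δ = δ} {u} (m , balance) = Moves⇒Within m $ begin
    u ℤ.+ + rise m               ≡⟨ cong (λ x → u ℤ.+ + x) balance ⟩
    u ℤ.+ (+ δ ℤ.+ + fall m)     ≡⟨ ℤP.+-assoc u (+ δ) (+ fall m) ⟨
    u ℤ.+ + δ ℤ.+ + fall m       ∎
    where open ≡-Reasoning

  Within⇒Displacement : ∀ {n δ u} → Within t n u (u ℤ.+ + δ) → Displacement t n δ
  Within⇒Displacement {δ = δ} {u} walk with Within⇒Moves walk
  ... | m , balance = m , ℤP.+-injective (∙-cancelˡ u _ _ (trans balance (ℤP.+-assoc u (+ δ) (+ fall m))))

  Displacement-mono : ∀ {m n δ} → m ≤ n → Displacement t m δ → Displacement t n δ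
  Displacement-mono m≤n (moves a b c f count≤ , balance) = moves a b c f (≤-trans count≤ m≤n) , balance

  twos : ∀ s → Displacement t s (s * 2)
  twos s = moves s 0 0 0 (≤-reflexive (trans (+-identityʳ (s + 0)) (+-identityʳ s))) , refl

  Displacement-stepₜ : ∀ {n δ} → Displacement t n δ → Displacement t (suc n) (t + δ)
  Displacement-stepₜ {δ = δ} (moves a b c f count≤ , balance) =
    moves a (suc b) c f (≤-trans (≤-reflexive (cong (_+ (c + f)) (+-suc a b))) (s≤s count≤)) , (begin
      stride t a (suc b)          ≡⟨ stride-sucₜ a b ⟩
      t + (a * 2 + b * t)         ≡⟨ cong (_+_ t) balance ⟩
      t + (δ + stride t c f)      ≡⟨ +-assoc t δ _ ⟨
      t + δ + stride t c f        ∎)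
    where open ≡-Reasoning

  t-minus-twos : ∀ {r w} → r + w * 2 ≡ t → Displacement t (suc w) r
  t-minus-twos {r} {w} r+2w≡t = moves 0 1 w 0 (s≤s (≤-reflexive (+-identityʳ w))) , (begin
    t + 0              ≡⟨ +-identityʳ t ⟩
    t                  ≡⟨ r+2w≡t ⟨
    r + w * 2          ≡⟨ cong (_+_ r) (+-identityʳ (w * 2)) ⟨
    r + (w * 2 + 0)    ∎)
    where open ≡-Reasoning

residue : ∀ k .{{_ : NonZero k}} → ℤ → Fin k
residue k u = fromℕ< (ℤ.n%ℕd<d u k)

same-residue⇒multiple : ∀ k .{{_ : NonZero k}} {u v} → residue k u ≡ residue k v →
  u ≡ v ⊎ ∃[ j ] (v ≡ u ℤ.+ + (suc j * k) ⊎ u ≡ v ℤ.+ + (suc j * k))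
same-residue⇒multiple k {u} {v} same = split (v /ℕ k ℤ.- u /ℕ k) (begin
    v                                              ≡⟨ ℤ.a≡a%ℕn+[a/ℕn]*n v k ⟩
    + (v %ℕ k) ℤ.+ v /ℕ k ℤ.* + k                  ≡⟨ cong (λ r → + r ℤ.+ v /ℕ k ℤ.* + k) same% ⟨
    + (u %ℕ k) ℤ.+ v /ℕ k ℤ.* + k                  ≡⟨ regroup (+ (u %ℕ k)) (u /ℕ k) (v /ℕ k) (+ k) ⟩
    + (u %ℕ k) ℤ.+ u /ℕ k ℤ.* + k ℤ.+ (v /ℕ k ℤ.- u /ℕ k) ℤ.* + k
                                                   ≡⟨ cong (λ x → x ℤ.+ (v /ℕ k ℤ.- u /ℕ k) ℤ.* + k) (ℤ.a≡a%ℕn+[a/ℕn]*n u k) ⟨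
    u ℤ.+ (v /ℕ k ℤ.- u /ℕ k) ℤ.* + k              ∎)
  where
  open ≡-Reasoning
  same% : u %ℕ k ≡ v %ℕ k
  same% = trans (sym (toℕ-fromℕ< _)) (trans (cong toℕ same) (toℕ-fromℕ< _))
  regroup : ∀ r a b K → r ℤ.+ b ℤ.* K ≡ r ℤ.+ a ℤ.* K ℤ.+ (b ℤ.- a) ℤ.* K
  regroup = ℤ-Solver.solve-∀
  return : ∀ u J K → u ≡ (u ℤ.+ ℤ.- J ℤ.* K) ℤ.+ J ℤ.* K
  return = ℤ-Solver.solve-∀
  split : ∀ J → v ≡ u ℤ.+ J ℤ.* + k → u ≡ v ⊎ ∃[ j ] (v ≡ u ℤ.+ + (suc j * k) ⊎ u ≡ v ℤ.+ + (suc j * k))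
  split (+ zero)  v≡ = inj₁ (sym (trans v≡ (ℤP.+-identityʳ u)))
  split +[1+ j ]  v≡ = inj₂ (j , inj₁ (trans v≡ (cong (ℤ._+_ u) (sym (ℤP.pos-* (suc j) k)))))
  split -[1+ j ]  v≡ = inj₂ (j , inj₂ (begin
    u                                      ≡⟨ return u (+ suc j) (+ k) ⟩
    u ℤ.+ -[1+ j ] ℤ.* + k ℤ.+ + suc j ℤ.* + k  ≡⟨ cong₂ ℤ._+_ (sym v≡) (sym (ℤP.pos-* (suc j) k)) ⟩
    v ℤ.+ + (suc j * k)                    ∎))

needs-colours : ∀ {t d k j} → (∀ {δ} → 1 ≤ δ → δ < k → Displacement t d δ) → j < k →
  ¬ DistColorable t d j
needs-colours {t} {d} {k} near j<k (f , proper) with pigeonhole j<k (λ i → f (+ toℕ i))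
... | i , i′ , i<i′ , same with m≤n⇒∃[o]m+o≡n i<i′
... | δ , i+1+δ≡i′ = proper (+ toℕ i) (+ toℕ i′) (λ eq → <⇒≢ i<i′ (ℤP.+-injective eq)) same
  (subst (Within t d (+ toℕ i)) (cong +_ i+[1+δ]≡i′) (Displacement⇒Within (near (s≤s z≤n) 1+δ<k)))
  where
  i+[1+δ]≡i′ : toℕ i + suc δ ≡ toℕ i′
  i+[1+δ]≡i′ = trans (+-suc (toℕ i) δ) i+1+δ≡i′
  1+δ<k : suc δ < k
  1+δ<k = ≤-<-trans (≤-trans (m≤n+m (suc δ) (toℕ i)) (≤-reflexive i+[1+δ]≡i′)) (toℕ<n i′)

suc∸-cases : ∀ L o → suc L ∸ o ≡ 0 ⊎ ∃[ a ] (suc L ∸ o ≡ suc a × a + o ≡ L)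
suc∸-cases L       zero          = inj₂ (L , refl , +-identityʳ L)
suc∸-cases zero    (suc zero)    = inj₁ refl
suc∸-cases zero    (suc (suc o)) = inj₁ refl
suc∸-cases (suc L) (suc o) with suc∸-cases L o
... | inj₁ eq               = inj₁ eq
... | inj₂ (a , eq , a+o≡L) = inj₂ (a , eq , trans (+-suc a o) (cong suc a+o≡L))

module _ {c : ℕ} (gaps : List ℕ) where

  -- A partial colouring lists the colours of L − 1, …, 1, 0, newest first, so that
  -- `drop o` reaches the vertex o steps back.
  differs-from-head : Fin c → List (Fin c) → Bool
  differs-from-head x []      = true
  differs-from-head x (y ∷ _) = not (does (x ≟ y))

  fresh : Fin c → List (Fin c) → Bool
  fresh x xs = all (λ o → differs-from-head x (drop o (x ∷ xs))) gaps

  extendable : ℕ → List (Fin c) → Bool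
  extendable zero    _  = true
  extendable (suc n) xs = any (λ x → fresh x xs ∧ extendable n (x ∷ xs)) (allFin c)

  module _ (g : ℕ → Fin c) (proper : ∀ {o} → o ∈ gaps → ∀ a → g a ≢ g (a + o)) where

    prefix : ℕ → List (Fin c)
    prefix zero    = []
    prefix (suc L) = g L ∷ prefix L

    drop-prefix : ∀ o L → drop o (prefix L) ≡ prefix (L ∸ o)
    drop-prefix zero    L       = refl
    drop-prefix (suc o) zero    = refl
    drop-prefix (suc o) (suc L) = drop-prefix o L

    fresh-prefix : ∀ L → T (fresh (g L) (prefix L))
    fresh-prefix L = all⁻ _ (All.tabulate fresh-at)
      where
      differs : ∀ {a} → g a ≢ g L → T (not (does (g L ≟ g a)))
      differs {a} ga≢gL with g L ≟ g a
      ... | yes gL≡ga = ga≢gL (sym gL≡ga)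
      ... | no _      = _
      fresh-at : ∀ {o} → o ∈ gaps → T (differs-from-head (g L) (drop o (prefix (suc L))))
      fresh-at {o} o∈ rewrite drop-prefix o (suc L) with suc∸-cases L o
      ... | inj₁ 1+L∸o≡0 rewrite 1+L∸o≡0 = _
      ... | inj₂ (a , 1+L∸o≡1+a , a+o≡L) rewrite 1+L∸o≡1+a =
        differs (subst (λ x → g a ≢ g x) a+o≡L (proper o∈ a))

    extendable-prefix : ∀ n L → T (extendable n (prefix L))
    extendable-prefix zero    L = _
    extendable-prefix (suc n) L = any⁺ _ (lose (∈-allFin (g L))
      (Equivalence.from T-∧ (fresh-prefix L , extendable-prefix n (suc L))))

  no-proper-colouring : ∀ n → extendable n [] ≡ false → (g : ℕ → Fin c) →
    ¬ (∀ {o} → o ∈ gaps → ∀ a → g a ≢ g (a + o))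
  no-proper-colouring n stuck g proper = subst T stuck (extendable-prefix g proper n 0)

stride≤ : ∀ {t} → 2 ≤ t → ∀ a b → stride t a b ≤ (a + b) * t
stride≤ {t} 2≤t a b = ≤-trans (+-monoˡ-≤ (b * t) (*-monoʳ-≤ a 2≤t)) (≤-reflexive (sym (*-distribʳ-+ t a b)))

half≤ : ∀ {s n} → s * 2 ≤ 1 + n * 2 → s ≤ n
half≤ {s} {n} le = s≤s⁻¹ (*-cancelʳ-< 2 s (suc n) (s≤s le))

odd≢even : ∀ a c → 1 + c * 2 ≢ a * 2
odd≢even a c eq = contradiction (trans (sym ([m+kn]%n≡m%n 1 c 2)) (trans (cong (_% 2) eq) (m*n%n≡0 a 2))) λ ()

module _ {p t : ℕ} (t≡2p+3 : t ≡ 1 + suc p * 2) where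

  2≤t : 2 ≤ t
  2≤t = subst (2 ≤_) (sym t≡2p+3) (s≤s (s≤s z≤n))

  twice-period-far : ∀ {e} j a b c f → p ≤ e →
    stride t a b ≡ suc (suc j) * (1 + t * e) + stride t c f → p + e < a + b + (c + f)
  twice-period-far {e} j a b c f p≤e balance =
    *-cancelʳ-< t (p + e) (a + b + (c + f)) $ begin-strict
      (p + e) * t                                ≤⟨ *-monoˡ-≤ t (+-monoˡ-≤ e p≤e) ⟩
      (e + e) * t                                ≡⟨ double e t ⟩
      2 * (t * e)                                <⟨ m<n+m (2 * (t * e)) {2} z<s ⟩
      2 + 2 * (t * e)                            ≡⟨ *-distribˡ-+ 2 1 (t * e) ⟨
      2 * (1 + t * e)                            ≤⟨ *-monoˡ-≤ (1 + t * e) {2} {suc (suc j)} (s≤s (s≤s z≤n)) ⟩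
      suc (suc j) * (1 + t * e)                  ≤⟨ m≤m+n _ (stride t c f) ⟩
      suc (suc j) * (1 + t * e) + stride t c f   ≡⟨ balance ⟨
      stride t a b                               ≤⟨ stride≤ 2≤t a b ⟩
      (a + b) * t                                ≤⟨ *-monoˡ-≤ t (m≤m+n (a + b) (c + f)) ⟩
      (a + b + (c + f)) * t                      ∎
    where
    open ≤-Reasoning
    double : ∀ e t → (e + e) * t ≡ 2 * (t * e)
    double = ℕ-Solver.solve-∀

  regroup-period : ∀ e a b c f → stride t a b ≡ 1 + t * e + stride t c f →
    a * 2 + b * t ≡ 1 + c * 2 + (f + e) * t
  regroup-period e a b c f balance = trans balance (regroup c f e t)
    where
    regroup : ∀ c f e t → 1 + t * e + (c * 2 + f * t) ≡ 1 + c * 2 + (f + e) * t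
    regroup = ℕ-Solver.solve-∀

  period-far-above : ∀ e a b c f r → stride t a b ≡ 1 + t * e + stride t c f →
    suc (f + e) + r ≡ b → p + e < a + b + (c + f)
  period-far-above e a b c f r balance refl = begin-strict
    p + e                      <⟨ n<1+n (p + e) ⟩
    suc p + e                  ≤⟨ +-mono-≤ suc-p≤c (≤-trans (m≤n+m e f) (≤-trans (n≤1+n _) (m≤m+n _ r))) ⟩
    c + b                      ≤⟨ m≤n+m (c + b) (a + f) ⟩
    a + f + (c + b)            ≡⟨ reorder a b c f ⟩
    a + b + (c + f)            ∎
    where
    open ≤-Reasoning
    reorder : ∀ a b c f → a + f + (c + b) ≡ a + b + (c + f)
    reorder = ℕ-Solver.solve-∀
    expand : ∀ a f e r t → a * 2 + suc r * t + (f + e) * t ≡ a * 2 + (suc (f + e) + r) * t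
    expand = ℕ-Solver.solve-∀
    cancelled : a * 2 + suc r * t ≡ 1 + c * 2
    cancelled = +-cancelʳ-≡ ((f + e) * t) _ _ (trans (expand a f e r t) (regroup-period e a b c f balance))
    suc-p≤c : suc p ≤ c
    suc-p≤c = *-cancelʳ-≤ (suc p) c 2 $ s≤s⁻¹ $ begin
      1 + suc p * 2              ≡⟨ t≡2p+3 ⟨
      t                          ≤⟨ m≤m+n t (r * t) ⟩
      suc r * t                  ≤⟨ m≤n+m _ (a * 2) ⟩
      a * 2 + suc r * t          ≡⟨ cancelled ⟩
      1 + c * 2                  ∎

  period-below-balance : ∀ e a b c f r → stride t a b ≡ 1 + t * e + stride t c f →
    b + r ≡ f + e → a * 2 ≡ 1 + c * 2 + r * t
  period-below-balance e a b c f r balance b+r≡f+e = +-cancelʳ-≡ (b * t) _ _ $ begin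
    a * 2 + b * t                ≡⟨ regroup-period e a b c f balance ⟩
    1 + c * 2 + (f + e) * t      ≡⟨ cong (λ x → 1 + c * 2 + x * t) b+r≡f+e ⟨
    1 + c * 2 + (b + r) * t      ≡⟨ expand b c r t ⟩
    1 + c * 2 + r * t + b * t    ∎
    where
    open ≡-Reasoning
    expand : ∀ b c r t → 1 + c * 2 + (b + r) * t ≡ 1 + c * 2 + r * t + b * t
    expand = ℕ-Solver.solve-∀

  period-far-below : ∀ e a b c f r → stride t a b ≡ 1 + t * e + stride t c f →
    b + r ≡ f + e → p + e < a + b + (c + f)
  period-far-below e a b c f zero balance b+r≡f+e =
    contradiction (sym (trans (period-below-balance e a b c f zero balance b+r≡f+e) (+-identityʳ _))) (odd≢even a c)
  period-far-below e a b c f (suc r) balance b+r≡f+e = begin-strict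
    p + e                        <⟨ s≤s (+-monoʳ-≤ p (m≤n+m e f)) ⟩
    suc p + (f + e)              ≡⟨ cong (_+_ (suc p)) b+r≡f+e ⟨
    suc p + (b + suc r)          ≡⟨ shuffle p b r ⟩
    suc (suc p) + r + b          ≤⟨ +-monoˡ-≤ b p+2+r≤a ⟩
    a + b                        ≤⟨ m≤m+n (a + b) (c + f) ⟩
    a + b + (c + f)              ∎
    where
    open ≤-Reasoning
    shuffle : ∀ p b r → suc p + (b + suc r) ≡ suc (suc p) + r + b
    shuffle = ℕ-Solver.solve-∀
    double : ∀ p r → (suc (suc p) + r) * 2 ≡ 1 + (1 + suc p * 2) + r * 2
    double = ℕ-Solver.solve-∀
    regroup : ∀ c r t → c * 2 + (1 + t + r * t) ≡ 1 + c * 2 + suc r * t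
    regroup = ℕ-Solver.solve-∀
    p+2+r≤a : suc (suc p) + r ≤ a
    p+2+r≤a = *-cancelʳ-≤ _ a 2 $ begin
      (suc (suc p) + r) * 2        ≡⟨ double p r ⟩
      1 + (1 + suc p * 2) + r * 2  ≡⟨ cong (λ x → 1 + x + r * 2) t≡2p+3 ⟨
      1 + t + r * 2                ≤⟨ +-monoʳ-≤ (1 + t) (*-monoʳ-≤ r 2≤t) ⟩
      1 + t + r * t                ≤⟨ m≤n+m _ (c * 2) ⟩
      c * 2 + (1 + t + r * t)      ≡⟨ regroup c r t ⟩
      1 + c * 2 + suc r * t        ≡⟨ period-below-balance e a b c f (suc r) balance b+r≡f+e ⟨
      a * 2                        ∎

  period-far : ∀ e a b c f → stride t a b ≡ 1 + t * e + stride t c f → p + e < a + b + (c + f)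
  period-far e a b c f balance with <-≤-connex (f + e) b
  ... | inj₁ f+e<b = period-far-above e a b c f _ balance (proj₂ (m≤n⇒∃[o]m+o≡n f+e<b))
  ... | inj₂ b≤f+e = period-far-below e a b c f _ balance (proj₂ (m≤n⇒∃[o]m+o≡n b≤f+e))

  multiple-of-period-far : ∀ {e} j → p ≤ e → ¬ Displacement t (p + e) (suc j * (1 + t * e))
  multiple-of-period-far {e} zero _ (moves a b c f count≤ , balance) =
    <⇒≱ (period-far e a b c f (trans balance (cong (_+ stride t c f) (*-identityˡ (1 + t * e))))) count≤
  multiple-of-period-far {e} (suc j) p≤e (moves a b c f count≤ , balance) =
    <⇒≱ (twice-period-far j a b c f p≤e balance) count≤

  residue-colouring : ∀ {e} → p ≤ e → IsDistColoring t (p + e) (1 + t * e) (residue (1 + t * e))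
  residue-colouring p≤e u v u≢v same walk with same-residue⇒multiple _ same
  ... | inj₁ u≡v            = u≢v u≡v
  ... | inj₂ (j , inj₁ v≡)  = multiple-of-period-far j p≤e
    (Within⇒Displacement (subst (Within _ _ u) v≡ walk))
  ... | inj₂ (j , inj₂ u≡)  = multiple-of-period-far j p≤e
    (Within⇒Displacement (subst (Within _ _ v) u≡ (Within-sym walk)))

  even-below-period : ∀ {r} s → r ≡ s * 2 → r ≤ t → Displacement t (suc p) r
  even-below-period s refl r≤t = Displacement-mono (half≤ (subst (s * 2 ≤_) t≡2p+3 r≤t)) (twos s)

  odd-below-period : ∀ {r} s → r ≡ 1 + s * 2 → 2 ≤ r → r ≤ t → Displacement t (suc p) r
  odd-below-period zero    refl (s≤s ())
  odd-below-period (suc s) refl _ r≤t with m≤n⇒∃[o]m+o≡n s≤p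
    where
    s≤p : s ≤ p
    s≤p = s≤s⁻¹ (*-cancelʳ-≤ (suc s) (suc p) 2 (s≤s⁻¹ (subst (1 + suc s * 2 ≤_) t≡2p+3 r≤t)))
  ... | w , s+w≡p = Displacement-mono (s≤s (subst (w ≤_) s+w≡p (m≤n+m w s))) (t-minus-twos (begin
    1 + suc s * 2 + w * 2    ≡⟨ regroup s w ⟩
    1 + suc (s + w) * 2      ≡⟨ cong (λ x → 1 + suc x * 2) s+w≡p ⟩
    1 + suc p * 2            ≡⟨ t≡2p+3 ⟨
    t                        ∎))
    where
    open ≡-Reasoning
    regroup : ∀ s w → 1 + suc s * 2 + w * 2 ≡ 1 + suc (s + w) * 2
    regroup = ℕ-Solver.solve-∀

  below-period : ∀ {r} → 2 ≤ r → r ≤ t → Displacement t (suc p) r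
  below-period {r} 2≤r r≤t with r % 2 | m≡m%n+[m/n]*n r 2 | m%n<n r 2
  ... | 0           | r≡2s   | _ = even-below-period (r / 2) r≡2s r≤t
  ... | 1           | r≡1+2s | _ = odd-below-period (r / 2) r≡1+2s 2≤r r≤t
  ... | suc (suc _) | _      | s≤s (s≤s ())

  k+p≤p+[k+e] : ∀ k e → k + p ≤ p + (k + e)
  k+p≤p+[k+e] k e = ≤-trans (≤-reflexive (+-comm k p)) (+-monoʳ-≤ p (m≤m+n k e))

  within-periods : ∀ e {δ} → 2 ≤ δ → δ ≤ t * suc e → Displacement t (p + suc e) δ
  within-periods e {δ} 2≤δ δ≤ with δ ≤? t
  ... | yes δ≤t = Displacement-mono (k+p≤p+[k+e] 1 e) (below-period 2≤δ δ≤t)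
  within-periods zero {δ} _ δ≤ | no δ≰t = contradiction (subst (δ ≤_) (*-identityʳ t) δ≤) δ≰t
  within-periods (suc e) {δ} _ δ≤ | no δ≰t with m≤n⇒∃[o]m+o≡n (≰⇒> δ≰t)
  ... | zero , t+1≡δ = Displacement-mono (k+p≤p+[k+e] 2 e) (subst (Displacement t _) (begin
    suc (suc p) * 2          ≡⟨ cong suc t≡2p+3 ⟨
    suc t                    ≡⟨ +-identityʳ (suc t) ⟨
    suc t + 0                ≡⟨ t+1≡δ ⟩
    δ                        ∎) (twos (suc (suc p))))
    where open ≡-Reasoning
  ... | suc o , t+o≡δ = subst₂ (Displacement t) (sym (+-suc p (suc e))) (trans (+-suc t (suc o)) t+o≡δ)
    (Displacement-stepₜ (within-periods e (s≤s (s≤s z≤n)) (+-cancelˡ-≤ t _ _ (begin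
      t + suc (suc o)      ≡⟨ trans (+-suc t (suc o)) t+o≡δ ⟩
      δ                    ≤⟨ δ≤ ⟩
      t * suc (suc e)      ≡⟨ *-suc t (suc e) ⟩
      t + t * suc e        ∎))))
    where open ≤-Reasoning

  near : ∀ {e δ} → 2 ≤ e → 1 ≤ δ → δ ≤ t * e → Displacement t (p + e) δ
  near {suc (suc e)} {1}           (s≤s (s≤s _)) _ _  = Displacement-mono (k+p≤p+[k+e] 2 e) (t-minus-twos (sym t≡2p+3))
  near {suc (suc e)} {suc (suc δ)} (s≤s (s≤s _)) _ δ≤ = within-periods (suc e) (s≤s (s≤s z≤n)) δ≤

-- the positive δ with d(0, δ) ≤ 2 in G(ℤ,{2,5})
gaps₅ : List ℕ
gaps₅ = 2 ∷ 3 ∷ 4 ∷ 5 ∷ 7 ∷ 10 ∷ []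

gap₅-near : ∀ {o} → o ∈ gaps₅ → 1 ≤ o × Displacement 5 2 o
gap₅-near (here refl)                                         = s≤s z≤n , (moves 1 0 0 0 (s≤s z≤n) , refl)
gap₅-near (there (here refl))                                 = s≤s z≤n , (moves 0 1 1 0 (s≤s (s≤s z≤n)) , refl)
gap₅-near (there (there (here refl)))                         = s≤s z≤n , (moves 2 0 0 0 (s≤s (s≤s z≤n)) , refl)
gap₅-near (there (there (there (here refl))))                 = s≤s z≤n , (moves 0 1 0 0 (s≤s z≤n) , refl)
gap₅-near (there (there (there (there (here refl)))))         = s≤s z≤n , (moves 1 1 0 0 (s≤s (s≤s z≤n)) , refl)
gap₅-near (there (there (there (there (there (here refl)))))) = s≤s z≤n , (moves 0 2 0 0 (s≤s (s≤s z≤n)) , refl)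

-- `refl` below runs the search: no 5-colouring of 0, …, 19 avoids every gap.
G₅-needs-six : ∀ j → j < 6 → ¬ DistColorable 5 2 j
G₅-needs-six j j<6 (f , proper) = no-proper-colouring gaps₅ 20 refl colour colour-proper
  where
  j≤5 : j ≤ 5
  j≤5 = s≤s⁻¹ j<6
  colour : ℕ → Fin 5
  colour i = inject≤ (f (+ i)) j≤5
  colour-proper : ∀ {o} → o ∈ gaps₅ → ∀ a → colour a ≢ colour (a + o)
  colour-proper {o} o∈ a same with gap₅-near o∈
  ... | 1≤o , near = proper (+ a) (+ (a + o)) (λ eq → <⇒≢ (m<m+n a 1≤o) (ℤP.+-injective eq))
    (inject≤-injective j≤5 j≤5 _ _ same) (Displacement⇒Within near)

2[1+p]+1≡1+[1+p]*2 : ∀ p → 2 * suc p + 1 ≡ 1 + suc p * 2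
2[1+p]+1≡1+[1+p]*2 = ℕ-Solver.solve-∀

chromatic-lower : ∀ p e → 1 ≤ p → p ≤ e → ∀ j → j < 1 + (2 * suc p + 1) * e →
  ¬ DistColorable (2 * suc p + 1) (p + e) j
chromatic-lower zero          zero          () _
chromatic-lower (suc p)       zero          _  ()
chromatic-lower zero          (suc zero)    () _
chromatic-lower (suc zero)    (suc zero)    _  _ = G₅-needs-six
chromatic-lower (suc (suc p)) (suc zero)    _  (s≤s ())
chromatic-lower p             (suc (suc e)) _  _ _ =
  needs-colours (λ 1≤δ δ<k → near (2[1+p]+1≡1+[1+p]*2 p) (s≤s (s≤s z≤n)) 1≤δ (s≤s⁻¹ δ<k))

chromatic-number : ∀ p e → 1 ≤ p → p ≤ e →
  ChiDistEq (2 * suc p + 1) (p + e) (1 + (2 * suc p + 1) * e)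
chromatic-number p e 1≤p p≤e = (residue _ , residue-colouring (2[1+p]+1≡1+[1+p]*2 p) p≤e) , chromatic-lower p e 1≤p p≤e

theorem8 : ∀ (m d : ℕ) → 2 ≤ m → (2 * m + 1) ∸ 3 ≤ d →
    ChiDistEq (2 * m + 1) d (1 + (2 * m + 1) * (d ∸ (m ∸ 1)))
theorem8 (suc (suc p)) d (s≤s (s≤s z≤n)) t-3≤d =
  subst (λ d′ → ChiDistEq (2 * suc q + 1) d′ (1 + (2 * suc q + 1) * (d ∸ q))) (m+[n∸m]≡n q≤d)
    (chromatic-number q (d ∸ q) (s≤s z≤n) q≤d∸q)
  where
  q = suc p
  t≡3+q+q : ∀ p → 2 * suc (suc p) + 1 ≡ 3 + (suc p + suc p)
  t≡3+q+q = ℕ-Solver.solve-∀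
  q+q≤d : q + q ≤ d
  q+q≤d = subst (_≤ d) (cong (_∸ 3) (t≡3+q+q p)) t-3≤d
  q≤d : q ≤ d
  q≤d = ≤-trans (m≤m+n q q) q+q≤d
  q≤d∸q : q ≤ d ∸ q
  q≤d∸q = subst (_≤ d ∸ q) (m+n∸n≡m q q) (∸-monoˡ-≤ q q+q≤d)
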